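{- Let $q\in\hat{\mathcal{Q}}_{n,p}$ be a pre-Q-tree of degree $n$ and base-length $p$, and let $\phi(q)=(q_0,q_1,\dots,q_m)$ be its decomposition. Then $q_0\in\mathcal{Q}_{m,p}$ and $q_i\in\hat{\mathcal{Q}}_{n_i,0}$ for $i=1,\dots,m$, with $\sum_{i=1}^m n_i=n$. Furthermore, $$\phi:\hat{\mathcal{Q}}_{n,p}\to\Big\{(q_0,q_1,\dots,q_m):0<m\le n,\ q_0\in\mathcal{Q}_{m,p},\ q_i\in\hat{\mathcal{Q}}_{n_i,0}\ \forall i>0,\ \textstyle\sum_{i=1}^m n_i=n\Big\}$$ is a bijection.
   Context: A rooted binary plane tree $T$ has a root $v_0$ of degree 1; every other vertex is a leaf (degree 1) or internal (degree 3, with parent edge $v^-$ and ordered left/right child edges $v^{\mathrm L},v^{\mathrm R}$). $e_0$ is the edge at $v_0$. A partition tree of degree $n$ and base-length $p$ is $(T,v_0,f_V,f_E)$ with $T$ having $n$ leaves, $f_V:V_I(T)\to\mathbb{Z}_{\ge0}$ on internal vertices, $f_E:E(T)\to\mathbb{Z}$, $f_V(v)=f_E(v^{\mathrm L})+f_E(v^{\mathrm R})-f_E(v^-)+1$ for all internal $v$, and $f_E(e_0)=p$. An edge is positive if its label is $>0$. An internal $v$ is a bottom vertex if $\mathbf{1}_{f_E(v^-)\le0}<\mathbf{1}_{f_E(v^{\mathrm L})\le0}+\mathbf{1}_{f_E(v^{\mathrm R})\le0}$. A pre-Q-tree of degree $n\ge1$ and base-length $p$ is a partition tree with $f_E(e)\le0$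 for every edge incident to a leaf and $f_V\equiv0$; $\hat{\mathcal{Q}}_{n,p}$ is their set. Paths: for each bottom vertex $v$, the regular path starts with the rightmost non-positive child edge of $v$ and then repeatedly continues with the leftmost non-positive child edge of the lower endpoint of the current edge, until a leaf; if $p\le0$, the root path starts with $e_0$ and continues by the same rule; for each bottom vertex $v$ with positive parent edge and two non-positive child edges, the special path starts with $v^{\mathrm L}$ and continues by the same rule. A path is strong if the edge labels along it attain a unique maximum at its last edge. A Q-tree is a pre-Q-tree all of whose paths are strong; $\mathcal{Q}_{n,p}$ is their set. Decomposition. For a non-positive edge $e$ of a pre-Q-tree, the truncation at $e$ is the tree obtained by contracting everything above $e$ (on the side not containing the root) into a single leaf, keeping all other labels; the removed subtree at $e$ is the tree obtained by contracting everything below $e$ (the side containing the root) into a single root vertex, so that $e$ becomes its root edge, keeping labels. For each path, its strongest edge is the edge closest to the root on which $f_E$ attains its maximum along the path. Let $D(q)$ be the set of strongest edges $e$ such that no other strongest edge lies on the path from the root to $e$. Let $m=|D(q)|$, let $q_0$ be the tree obtained by truncating $q$ at all edges of $D(q)$, and for $i=1,\dots,m$ let $\tilde q_i$ be the removed subtree at the $i$th edge of $D(q)$ (edges of $D(q)$ ordered according to the left-to-right order of the corresponding leaves of $q_0$). The rebasing of $\tilde q_i$ is the tree $q_i$ obtained by lowering the label of every edge on the root path of $\tilde q_i$ by the label of its root edge. The decomposition is $\phi(q)=(q_0,q_1,\dots,q_m)$. -}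

module Defs where

open import Data.Bool using (Bool; true; false; if_then_else_; _∧_; not)
open import Data.Nat as ℕ using (ℕ)
open import Data.Integer as ℤ using (ℤ; _-_; _⊔_; 0ℤ; 1ℤ) renaming (_+_ to _+ℤ_)
open import Data.List using (List; []; _∷_; _∷ʳ_; _++_; filterᵇ; length; map)
open import Data.Bool.ListAction using (any)
open import Data.Nat.ListAction using (sum)
open import Data.List.NonEmpty using (List⁺; _∷_; toList)
open import Data.List.Relation.Unary.All using (All)
open import Data.Product using (_×_; _,_; proj₁; proj₂)
open import Data.Unit using (⊤)
open import Relation.Nullary using (does)
open import Relation.Binary.PropositionalEquality using (_≡_)
import Data.List.Properties as LP
import Data.Bool.Properties as BP

-- A value of type Tree represents the subtree hanging below an edge,
-- together with the label of that edge.  The whole tree (T, v₀) is the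
-- subtree below the root edge e₀ (v₀ itself is implicit).
--   leaf x       : the edge (labelled x) ends in a leaf
--   node x l r   : the edge (labelled x) ends in an internal vertex v
--                  with left child subtree l and right child subtree r
-- The vertex labels f_V are determined by the f_E labels via
-- f_V(v) = f_E(vᴸ) + f_E(vᴿ) - f_E(v⁻) + 1.

data Tree : Set where
  leaf : ℤ → Tree
  node : ℤ → Tree → Tree → Tree

lab : Tree → ℤ
lab (leaf x) = x
lab (node x _ _) = x

leaves : Tree → ℕ
leaves (leaf _) = 1
leaves (node _ l r) = leaves l ℕ.+ leaves r

fV : ℤ → Tree → Tree → ℤ
fV x l r = lab l +ℤ lab r - x +ℤ 1ℤ

-- leaf edges non-positive, f_V ≡ 0 at all internal vertices
-- (f_V ≡ 0 in particular gives f_V ≥ 0, the partition-tree condition)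
PreQLabels : Tree → Set
PreQLabels (leaf x) = x ℤ.≤ 0ℤ
PreQLabels (node x l r) = (fV x l r ≡ 0ℤ) × PreQLabels l × PreQLabels r

IsPreQ : ℕ → ℤ → Tree → Set
IsPreQ n p t = (leaves t ≡ n) × (lab t ≡ p) × PreQLabels t

-- edge addresses: sequence of left(false)/right(true) steps from e₀
Addr : Set
Addr = List Bool

nonpos : ℤ → Bool
nonpos x = does (x ℤ.≤? 0ℤ)

pos : ℤ → Bool
pos x = not (nonpos x)

ind : ℤ → ℕ
ind x = if nonpos x then 1 else 0

isBottom : ℤ → Tree → Tree → Bool
isBottom x l r = does (ind x ℕ.<? (ind (lab l) ℕ.+ ind (lab r)))

-- A path, as the list of its edges (address, label) from top to bottom.
Path : Set
Path = List⁺ (Addr × ℤ)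

follow : Addr → Tree → Path
follow a (leaf x) = (a , x) ∷ []
follow a (node x l r) =
  (a , x) ∷ toList (if nonpos (lab l) then follow (a ∷ʳ false) l
                                      else follow (a ∷ʳ true) r)

-- regular and special paths of all bottom vertices in the subtree at a
nodePaths : Addr → Tree → List Path
nodePaths a (leaf _) = []
nodePaths a (node x l r) =
  (if isBottom x l r
     then ((if nonpos (lab r) then follow (a ∷ʳ true) r
                              else follow (a ∷ʳ false) l) ∷ [])
     else [])
  ++ (if isBottom x l r ∧ pos x ∧ nonpos (lab l) ∧ nonpos (lab r)
        then (follow (a ∷ʳ false) l ∷ [])
        else [])
  ++ nodePaths (a ∷ʳ false) l ++ nodePaths (a ∷ʳ true) r

allPaths : Tree → List Path
allPaths t = (if nonpos (lab t) then (follow [] t ∷ []) else []) ++ nodePaths [] t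

-- strong: the labels attain a unique maximum at the last edge
lastOf : ℤ → List ℤ → ℤ
lastOf y [] = y
lastOf y (z ∷ zs) = lastOf z zs

StrongAux : ℤ → List ℤ → Set
StrongAux x [] = ⊤
StrongAux x (y ∷ ys) = (x ℤ.< lastOf y ys) × StrongAux y ys

StrongPath : Path → Set
StrongPath (h ∷ t) = StrongAux (proj₂ h) (map proj₂ t)

IsQ : ℕ → ℤ → Tree → Set
IsQ n p t = IsPreQ n p t × All StrongPath (allPaths t)

maxAux : Addr × ℤ → List (Addr × ℤ) → ℤ
maxAux (a , x) [] = x
maxAux (a , x) (y ∷ ys) = x ⊔ maxAux y ys

-- first (closest to the root) edge attaining the maximum
strongestAux : Addr × ℤ → List (Addr × ℤ) → Addr
strongestAux (a , x) [] = a
strongestAux (a , x) (y ∷ ys) =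
  if does (maxAux y ys ℤ.≤? x) then a else strongestAux y ys

strongestEdge : Path → Addr
strongestEdge (h ∷ t) = strongestAux h t

strongestEdges : Tree → List Addr
strongestEdges t = map strongestEdge (allPaths t)

_≟A_ : (a b : Addr) → _
_≟A_ = LP.≡-dec BP._≟_

isStrictPrefix : Addr → Addr → Bool
isStrictPrefix [] [] = false
isStrictPrefix [] (_ ∷ _) = true
isStrictPrefix (_ ∷ _) [] = false
isStrictPrefix (x ∷ xs) (y ∷ ys) = does (x BP.≟ y) ∧ isStrictPrefix xs ys

Dset : Tree → List Addr
Dset t = filterᵇ (λ a → not (any (λ b → isStrictPrefix b a) S)) S
  where S = strongestEdges t

inD : Tree → Addr → Bool
inD t a = any (λ b → does (a ≟A b)) (Dset t)

-- truncate at all edges satisfying d (which form an antichain), returning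
-- the truncated tree and the removed subtrees in left-to-right order
trunc : (Addr → Bool) → Addr → Tree → Tree × List Tree
trunc d a (leaf x) = if d a then (leaf x , leaf x ∷ []) else (leaf x , [])
trunc d a (node x l r) =
  if d a then (leaf x , node x l r ∷ [])
  else (node x (proj₁ (trunc d (a ∷ʳ false) l)) (proj₁ (trunc d (a ∷ʳ true) r))
       , proj₂ (trunc d (a ∷ʳ false) l) ++ proj₂ (trunc d (a ∷ʳ true) r))

rebaseBy : ℤ → Tree → Tree
rebaseBy c (leaf x) = leaf (x - c)
rebaseBy c (node x l r) =
  if nonpos (lab l) then node (x - c) (rebaseBy c l) r
                    else node (x - c) l (rebaseBy c r)

rebase : Tree → Tree
rebase t = rebaseBy (lab t) t

φ : Tree → Tree × List Tree
φ t = proj₁ (trunc (inD t) [] t) , map rebase (proj₂ (trunc (inD t) [] t))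

-- The target set  { (q₀,q₁,…,q_m) : 0<m≤n, q₀ ∈ Q_{m,p},
--                   q_i ∈ \hat{Q}_{n_i,0}, Σ n_i = n }
-- (n_i is necessarily the degree = number of leaves of q_i)
InTarget : ℕ → ℤ → Tree × List Tree → Set
InTarget n p (q₀ , qs) =
  (0 ℕ.< length qs) × (length qs ℕ.≤ n) × IsQ (length qs) p q₀
  × All (λ qi → IsPreQ (leaves qi) 0ℤ qi) qs
  × (sum (map leaves qs) ≡ n)

-- Every non-positive edge of a pre-Q-tree lies on exactly one path, and
-- an edge is the strongest edge of its path iff it is non-positive, its
-- label exceeds the maximum M of the labels above it on the path, and no
-- label below it on the path exceeds it.  Carrying M down the tree as a
-- threshold turns the strongest edges, and the truncation at the topmost
-- ones, into a single top-down recursion (cut), which is inverted by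
-- grafting the removed subtrees, raised back, onto the leaves of q₀.
-- Cutting a path at its strongest edge leaves a path whose last edge is its
-- unique maximum, so q₀ is a Q-tree; conversely, grafting rebased pre-Q-trees
-- onto the leaves of a Q-tree makes the grafting edges the topmost strongest
-- edges, because rebased trees have non-positive spines.

module Submission where

open import Defs
open import Data.Nat using (ℕ)
open import Data.Integer using (ℤ)
open import Data.List using (List)
open import Data.Product using (Σ; _×_; _,_)
open import Relation.Binary.PropositionalEquality using (_≡_)

open import Algebra.Bundles using (CommutativeMonoid)
open import Data.Bool using (Bool; true; false; if_then_else_; _∧_; not; T)
import Data.Bool.Properties as BP
open import Data.Bool.Properties using (T-≡; ∧-conicalˡ; ∧-conicalʳ; ∧-zeroʳ; ∧-identityʳ)
open import Data.Bool.ListAction using (any)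
open import Data.Empty using (⊥; ⊥-elim)
open import Data.Integer as ℤ using (_-_; _⊔_; 0ℤ; 1ℤ; -1ℤ; _<?_; _≤?_) renaming (_+_ to _+ℤ_)
import Data.Integer.Properties as ℤₚ
open import Data.Integer.Tactic.RingSolver using (solve-∀)
open import Data.List using ([]; _∷_; _∷ʳ_; _++_; filter; length; map)
open import Data.List.Membership.Propositional using (_∈_; _∉_; find; lose)
open import Data.List.Membership.Propositional.Properties
  using (∈-++⁻; ∈-++⁺ˡ; ∈-++⁺ʳ; ∈-filter⁺; ∈-filter⁻)
open import Data.List.NonEmpty using (_∷_; toList; head; tail)
open import Data.List.Properties
  using (map-++; map-∘; map-cong; ++-assoc; ++-identityʳ; ++-cancelˡ; ∷-injectiveˡ; length-++; length-map)
open import Data.List.Relation.Binary.Permutation.Propositional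
  using (_↭_; ↭-refl; ↭-sym; ↭-trans; ↭-reflexive; module PermutationReasoning)
open import Data.List.Relation.Binary.Permutation.Propositional.Properties as ↭
  using (++⁺; ++⁺ˡ; ++⁺ʳ; ++-commutativeMonoid; ∈-resp-↭)
open import Data.List.Relation.Unary.All as All using (All; []; _∷_)
import Data.List.Relation.Unary.All.Properties as Allₚ
import Data.List.Relation.Unary.Any as Any
open import Data.List.Relation.Unary.Any using (here)
open import Data.List.Relation.Unary.Any.Properties using (any⁺; any⁻)
import Data.Nat as ℕ
import Data.Nat.Properties as ℕₚ
open import Data.Nat.ListAction using (sum)
open import Data.Nat.ListAction.Properties using (sum-++)
open import Data.Product using (∃; proj₁; proj₂)
open import Data.Product.Function.NonDependent.Propositional using (_×-⇔_)
open import Data.Sum as Sum using (_⊎_; inj₁; inj₂)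
open import Data.Unit using (⊤; tt)
open import Function using (_⇔_; mk⇔; Equivalence; id; _∘_)
open import Function.Properties.Equivalence using () renaming (refl to ⇔-refl; trans to ⇔-trans)
open import Relation.Binary.PropositionalEquality
  using (refl; sym; trans; cong; cong₂; subst; subst₂; module ≡-Reasoning)
open import Relation.Nullary using (Dec; yes; no; does; ¬_; contradiction)
open import Relation.Nullary.Decidable using (dec-true; dec-false; T?)
open import Relation.Unary using (Decidable)

open import Algebra.Properties.CommutativeSemigroup
  (CommutativeMonoid.commutativeSemigroup (++-commutativeMonoid {A = Addr})) using (interchange)

open Equivalence using (to; from)

does≡true⇒ : ∀ {P : Set} (P? : Dec P) → does P? ≡ true → P
does≡true⇒ (yes p) _ = p
does≡true⇒ (no _) ()

does≡false⇒ : ∀ {P : Set} (P? : Dec P) → does P? ≡ false → ¬ P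
does≡false⇒ (no ¬p) _ = ¬p
does≡false⇒ (yes _) ()

≡true⇔≡true⇒≡ : ∀ {b c : Bool} → (b ≡ true ⇔ c ≡ true) → b ≡ c
≡true⇔≡true⇒≡ {false} {false} _ = refl
≡true⇔≡true⇒≡ {false} {true}  b⇔c = from b⇔c refl
≡true⇔≡true⇒≡ {true}  {false} b⇔c = sym (to b⇔c refl)
≡true⇔≡true⇒≡ {true}  {true}  _ = refl

T-does⇔ : ∀ {P : Set} (P? : Dec P) → T (does P?) ⇔ P
T-does⇔ (yes p) = mk⇔ (λ _ → p) (λ _ → tt)
T-does⇔ (no ¬p) = mk⇔ (λ ()) (λ p → ¬p p)

T-not⇔¬T : ∀ {b} → T (not b) ⇔ (¬ T b)
T-not⇔¬T {true} = mk⇔ (λ ()) (λ ¬T → ¬T tt)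
T-not⇔¬T {false} = mk⇔ (λ _ ()) (λ _ → tt)

if-else-cong : ∀ {A : Set} b {x y z : A} → (b ≡ false → y ≡ z) →
  (if b then x else y) ≡ (if b then x else z)
if-else-cong true _ = refl
if-else-cong false y≡z = y≡z refl

∈-if : ∀ {A : Set} b {x c : A} → c ∈ (if b then x ∷ [] else []) → c ≡ x × b ≡ true
∈-if true (here refl) = refl , refl

∈-++⇔ˡ : ∀ {A : Set} {c : A} xs {ys} → c ∉ ys → c ∈ xs ++ ys ⇔ c ∈ xs
∈-++⇔ˡ xs c∉ys = mk⇔ (λ c∈ → Sum.[ id , (λ c∈ys → contradiction c∈ys c∉ys) ] (∈-++⁻ xs c∈)) ∈-++⁺ˡ

∈-++⇔ʳ : ∀ {A : Set} {c : A} xs {ys} → c ∉ xs → c ∈ xs ++ ys ⇔ c ∈ ys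
∈-++⇔ʳ xs c∉xs = mk⇔ (λ c∈ → Sum.[ (λ c∈xs → contradiction c∈xs c∉xs) , id ] (∈-++⁻ xs c∈)) (∈-++⁺ʳ xs)

All-++⇔ : ∀ {A : Set} {P : A → Set} {Q R : Set} xs {ys} →
  (All P xs ⇔ Q) → (All P ys ⇔ R) → All P (xs ++ ys) ⇔ (Q × R)
All-++⇔ xs xs⇔ ys⇔ = mk⇔
  (λ all → let (all-xs , all-ys) = Allₚ.++⁻ xs all in to xs⇔ all-xs , to ys⇔ all-ys)
  (λ (q , r) → Allₚ.++⁺ (from xs⇔ q) (from ys⇔ r))

All-[]⇔ : ∀ {A B : Set} {P : A → Set} {Q : B → Set} {x y} → (P x ⇔ Q y) → All P (x ∷ []) ⇔ All Q (y ∷ [])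
All-[]⇔ x⇔y = mk⇔ (λ all → to x⇔y (All.head all) ∷ []) (λ all → from x⇔y (All.head all) ∷ [])

x-1<x : ∀ x → x - 1ℤ ℤ.< x
x-1<x x = ℤₚ.i≤pred[j]⇒i<j (ℤₚ.≤-reflexive (ℤₚ.+-comm x -1ℤ))

⊔-lub-< : ∀ {i j k} → i ℤ.< k → j ℤ.< k → i ⊔ j ℤ.< k
⊔-lub-< {i} {j} i<k j<k with ℤₚ.⊔-sel i j
... | inj₁ i⊔j≡i = subst (ℤ._< _) (sym i⊔j≡i) i<k
... | inj₂ i⊔j≡j = subst (ℤ._< _) (sym i⊔j≡j) j<k

i⊔j<k⇒i<k : ∀ {i j k} → i ⊔ j ℤ.< k → i ℤ.< k
i⊔j<k⇒i<k {i} {j} = ℤₚ.≤-<-trans (ℤₚ.i≤i⊔j i j)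

i⊔j<k⇒j<k : ∀ {i j k} → i ⊔ j ℤ.< k → j ℤ.< k
i⊔j<k⇒j<k {i} {j} = ℤₚ.≤-<-trans (ℤₚ.i≤j⊔i i j)

x≤c⇒x-c≤0 : ∀ {x c} → x ℤ.≤ c → x - c ℤ.≤ 0ℤ
x≤c⇒x-c≤0 {x} {c} x≤c = subst (x - c ℤ.≤_) (ℤₚ.+-inverseʳ c) (ℤₚ.+-monoˡ-≤ (ℤ.- c) x≤c)

x≤0⇒x+c≤c : ∀ {x} c → x ℤ.≤ 0ℤ → x +ℤ c ℤ.≤ c
x≤0⇒x+c≤c {x} c x≤0 = subst (x +ℤ c ℤ.≤_) (ℤₚ.+-identityˡ c) (ℤₚ.+-monoˡ-≤ c x≤0)

x-c+c≡x : ∀ x c → (x - c) +ℤ c ≡ x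
x-c+c≡x = solve-∀

x+c-c≡x : ∀ x c → (x +ℤ c) - c ≡ x
x+c-c≡x = solve-∀

nonpos⇒≤0 : ∀ {x} → nonpos x ≡ true → x ℤ.≤ 0ℤ
nonpos⇒≤0 {x} = does≡true⇒ (x ≤? 0ℤ)

≤0⇒nonpos : ∀ {x} → x ℤ.≤ 0ℤ → nonpos x ≡ true
≤0⇒nonpos {x} = dec-true (x ≤? 0ℤ)

¬nonpos⇒≰0 : ∀ {x} → nonpos x ≡ false → ¬ (x ℤ.≤ 0ℤ)
¬nonpos⇒≰0 {x} = does≡false⇒ (x ≤? 0ℤ)

fV≡0⇒lab≡ : ∀ x l r → fV x l r ≡ 0ℤ → x ≡ lab l +ℤ lab r +ℤ 1ℤ
fV≡0⇒lab≡ x l r fV≡0 = begin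
  x                                    ≡⟨ solve-for-x (lab l) (lab r) x ⟩
  lab l +ℤ lab r +ℤ 1ℤ - fV x l r      ≡⟨ cong (λ v → lab l +ℤ lab r +ℤ 1ℤ - v) fV≡0 ⟩
  lab l +ℤ lab r +ℤ 1ℤ - 0ℤ            ≡⟨ ℤₚ.+-identityʳ _ ⟩
  lab l +ℤ lab r +ℤ 1ℤ                 ∎
  where
  open ≡-Reasoning
  solve-for-x : ∀ a b x → x ≡ a +ℤ b +ℤ 1ℤ - (a +ℤ b - x +ℤ 1ℤ)
  solve-for-x = solve-∀

nonpos-edge-has-nonpos-child : ∀ {x l r} → fV x l r ≡ 0ℤ → x ℤ.≤ 0ℤ →
  nonpos (lab l) ≡ false → lab r ℤ.≤ 0ℤ
nonpos-edge-has-nonpos-child {x} {l} {r} fV≡0 x≤0 l-pos with lab r ≤? 0ℤ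
... | yes r≤0 = r≤0
... | no r≰0 = contradiction x≤0 (ℤₚ.<⇒≱ (subst (0ℤ ℤ.<_) (sym (fV≡0⇒lab≡ x l r fV≡0)) 0<l+r+1))
  where
  0≤l+r : 0ℤ ℤ.≤ lab l +ℤ lab r
  0≤l+r = ℤₚ.+-mono-≤ (ℤₚ.<⇒≤ (ℤₚ.≰⇒> (¬nonpos⇒≰0 {lab l} l-pos))) (ℤₚ.<⇒≤ (ℤₚ.≰⇒> r≰0))
  0<l+r+1 : 0ℤ ℤ.< lab l +ℤ lab r +ℤ 1ℤ
  0<l+r+1 = ℤₚ.suc[i]≤j⇒i<j (ℤₚ.+-monoˡ-≤ 1ℤ 0≤l+r)

¬nonpos-edge-with-pos-children : ∀ {x l r} → fV x l r ≡ 0ℤ → nonpos x ≡ true →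
  nonpos (lab l) ≡ false → nonpos (lab r) ≡ false → ⊥
¬nonpos-edge-with-pos-children {x} {l} {r} fV≡0 x≤0 l>0 r>0 =
  ¬nonpos⇒≰0 r>0 (nonpos-edge-has-nonpos-child {x} {l} {r} fV≡0 (nonpos⇒≤0 x≤0) l>0)

fV-resp-lab : ∀ x l r l′ r′ → lab l′ ≡ lab l → lab r′ ≡ lab r → fV x l r ≡ 0ℤ → fV x l′ r′ ≡ 0ℤ
fV-resp-lab x _ _ _ _ l′≡l r′≡r = trans (cong₂ (λ y z → y +ℤ z - x +ℤ 1ℤ) l′≡l r′≡r)

fV-shiftˡ : ∀ a b x c → (a +ℤ c) +ℤ b - (x +ℤ c) +ℤ 1ℤ ≡ a +ℤ b - x +ℤ 1ℤ
fV-shiftˡ = solve-∀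

fV-shiftʳ : ∀ a b x c → a +ℤ (b +ℤ c) - (x +ℤ c) +ℤ 1ℤ ≡ a +ℤ b - x +ℤ 1ℤ
fV-shiftʳ = solve-∀

-- The spine of s is the path  follow a s  (for any address a): spineMax and
-- spineEnd are the maximum and the last of its labels.

spineMax : Tree → ℤ
spineMax (leaf x) = x
spineMax (node x l r) = x ⊔ (if nonpos (lab l) then spineMax l else spineMax r)

spineEnd : Tree → ℤ
spineEnd (leaf x) = x
spineEnd (node x l r) = if nonpos (lab l) then spineEnd l else spineEnd r

StrongSpine : Tree → Set
StrongSpine (leaf _) = ⊤
StrongSpine (node x l r) =
  if nonpos (lab l) then x ℤ.< spineEnd l × StrongSpine l
                    else x ℤ.< spineEnd r × StrongSpine r

lab≤spineMax : ∀ s → lab s ℤ.≤ spineMax s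
lab≤spineMax (leaf x) = ℤₚ.≤-refl
lab≤spineMax (node x l r) = ℤₚ.i≤i⊔j x _

lab≤spineEnd : ∀ s → StrongSpine s → lab s ℤ.≤ spineEnd s
lab≤spineEnd (leaf x) _ = ℤₚ.≤-refl
lab≤spineEnd (node x l r) strong with nonpos (lab l)
... | true  = ℤₚ.<⇒≤ (proj₁ strong)
... | false = ℤₚ.<⇒≤ (proj₁ strong)

lab-1<spineMax : ∀ s → lab s - 1ℤ ℤ.< spineMax s
lab-1<spineMax s = ℤₚ.<-≤-trans (x-1<x (lab s)) (lab≤spineMax s)

lab-1<spineEnd : ∀ s → StrongSpine s → lab s - 1ℤ ℤ.< spineEnd s
lab-1<spineEnd s strong = ℤₚ.<-≤-trans (x-1<x (lab s)) (lab≤spineEnd s strong)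

follow-max : ∀ a s → maxAux (head (follow a s)) (tail (follow a s)) ≡ spineMax s
follow-max a (leaf x) = refl
follow-max a (node x l r) with nonpos (lab l)
... | true  = cong (x ⊔_) (follow-max (a ∷ʳ false) l)
... | false = cong (x ⊔_) (follow-max (a ∷ʳ true) r)

follow-end : ∀ a s → lastOf (proj₂ (head (follow a s))) (map proj₂ (tail (follow a s))) ≡ spineEnd s
follow-end a (leaf x) = refl
follow-end a (node x l r) with nonpos (lab l)
... | true  = follow-end (a ∷ʳ false) l
... | false = follow-end (a ∷ʳ true) r

strongPath-∷⇔ : ∀ {a x} a′ c → (StrongPath (follow a′ c) ⇔ StrongSpine c) →
  StrongPath ((a , x) ∷ toList (follow a′ c)) ⇔ (x ℤ.< spineEnd c × StrongSpine c)
strongPath-∷⇔ {x = x} a′ c strong⇔ = mk⇔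
  (λ (x<end , strong) → subst (x ℤ.<_) (follow-end a′ c) x<end , to strong⇔ strong)
  (λ (x<end , strong) → subst (x ℤ.<_) (sym (follow-end a′ c)) x<end , from strong⇔ strong)

follow-strong⇔ : ∀ a s → StrongPath (follow a s) ⇔ StrongSpine s
follow-strong⇔ a (leaf x) = mk⇔ (λ _ → tt) (λ _ → tt)
follow-strong⇔ a (node x l r) with nonpos (lab l)
... | true  = strongPath-∷⇔ {a} {x} (a ∷ʳ false) l (follow-strong⇔ (a ∷ʳ false) l)
... | false = strongPath-∷⇔ {a} {x} (a ∷ʳ true) r (follow-strong⇔ (a ∷ʳ true) r)

regularPaths : Addr → ℤ → Tree → Tree → List Path
regularPaths a x l r =
  if isBottom x l r then (if nonpos (lab r) then follow (a ∷ʳ true) r else follow (a ∷ʳ false) l) ∷ []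
                    else []

specialPaths : Addr → ℤ → Tree → Tree → List Path
specialPaths a x l r =
  if isBottom x l r ∧ pos x ∧ nonpos (lab l) ∧ nonpos (lab r) then follow (a ∷ʳ false) l ∷ [] else []

regularStarts : ℤ → Tree → Tree → List Tree
regularStarts x l r = if isBottom x l r then (if nonpos (lab r) then r else l) ∷ [] else []

specialStarts : ℤ → Tree → Tree → List Tree
specialStarts x l r =
  if isBottom x l r ∧ pos x ∧ nonpos (lab l) ∧ nonpos (lab r) then l ∷ [] else []

PathsStrong : Tree → Set
PathsStrong (leaf _) = ⊤
PathsStrong (node x l r) =
  All StrongSpine (regularStarts x l r) × All StrongSpine (specialStarts x l r)
  × PathsStrong l × PathsStrong r

startPath-strong⇔ : ∀ b c aˡ aʳ l r →
  All StrongPath (if b then (if c then follow aʳ r else follow aˡ l) ∷ [] else [])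
  ⇔ All StrongSpine (if b then (if c then r else l) ∷ [] else [])
startPath-strong⇔ false c aˡ aʳ l r = mk⇔ (λ _ → []) (λ _ → [])
startPath-strong⇔ true true aˡ aʳ l r = All-[]⇔ (follow-strong⇔ aʳ r)
startPath-strong⇔ true false aˡ aʳ l r = All-[]⇔ (follow-strong⇔ aˡ l)

nodePaths-strong⇔ : ∀ a s → All StrongPath (nodePaths a s) ⇔ PathsStrong s
nodePaths-strong⇔ a (leaf x) = mk⇔ (λ _ → tt) (λ _ → [])
nodePaths-strong⇔ a (node x l r) =
  All-++⇔ _ (startPath-strong⇔ (isBottom x l r) (nonpos (lab r)) aˡ aʳ l r)
    (All-++⇔ _ (startPath-strong⇔ (isBottom x l r ∧ pos x ∧ nonpos (lab l) ∧ nonpos (lab r)) false aˡ aʳ l r)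
      (All-++⇔ _ (nodePaths-strong⇔ aˡ l) (nodePaths-strong⇔ aʳ r)))
  where
  aˡ = a ∷ʳ false
  aʳ = a ∷ʳ true

-- The labels above the spine of s on the path through its root edge are
-- bounded by a threshold M: a child edge either continues the path through
-- its parent edge x (threshold M ⊔ x), or starts a new path, in which case
-- its own label minus one is a threshold that bounds nothing.

thresholdˡ : ℤ → ℤ → ℤ → ℤ
thresholdˡ M x y = if nonpos x ∧ nonpos y then M ⊔ x else y - 1ℤ

thresholdʳ : ℤ → ℤ → ℤ → ℤ → ℤ
thresholdʳ M x y z = if nonpos x ∧ pos y then M ⊔ x else z - 1ℤ

StrongUnder : ℤ → Tree → Set
StrongUnder M s = (nonpos (lab s) ≡ true → StrongSpine s × M ℤ.< spineEnd s) × PathsStrong s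

fresh-strong : ∀ s → StrongSpine s → StrongSpine s × lab s - 1ℤ ℤ.< spineEnd s
fresh-strong s strong = strong , lab-1<spineEnd s strong

rootPath-strong⇔ : ∀ b t → All StrongPath (if b then follow [] t ∷ [] else []) ⇔ (b ≡ true → StrongSpine t)
rootPath-strong⇔ true t = mk⇔ (λ all _ → to (follow-strong⇔ [] t) (All.head all))
                             (λ strong → from (follow-strong⇔ [] t) (strong refl) ∷ [])
rootPath-strong⇔ false t = mk⇔ (λ _ ()) (λ _ → [])

allPaths-strong⇔ : ∀ t → All StrongPath (allPaths t) ⇔ StrongUnder (lab t - 1ℤ) t
allPaths-strong⇔ t = mk⇔
  (λ all → let (root , paths) = to all-++ all in
     (λ nonpos-t → fresh-strong t (root nonpos-t)) , paths)
  (λ (root , paths) → from all-++ ((λ nonpos-t → proj₁ (root nonpos-t)) , paths))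
  where
  all-++ = All-++⇔ _ (rootPath-strong⇔ (nonpos (lab t)) t) (nodePaths-strong⇔ [] t)

StrongUnder-node⁺ : ∀ M x l r → fV x l r ≡ 0ℤ →
  StrongUnder (thresholdˡ M x (lab l)) l → StrongUnder (thresholdʳ M x (lab l) (lab r)) r →
  StrongUnder M (node x l r)
StrongUnder-node⁺ M x l r fV≡0 (root-l , paths-l) (root-r , paths-r)
  with nonpos x in x≤0? | nonpos (lab l) in l≤0? | nonpos (lab r) in r≤0?
... | true | true | true = let (spine , M⊔x<end) = root-l refl in
  (λ _ → (i⊔j<k⇒j<k M⊔x<end , spine) , i⊔j<k⇒i<k M⊔x<end)
  , proj₁ (root-r refl) ∷ [] , [] , paths-l , paths-r
... | true | true | false = let (spine , M⊔x<end) = root-l refl in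
  (λ _ → (i⊔j<k⇒j<k M⊔x<end , spine) , i⊔j<k⇒i<k M⊔x<end) , [] , [] , paths-l , paths-r
... | true | false | true = let (spine , M⊔x<end) = root-r refl in
  (λ _ → (i⊔j<k⇒j<k M⊔x<end , spine) , i⊔j<k⇒i<k M⊔x<end) , [] , [] , paths-l , paths-r
... | true | false | false =
  ⊥-elim (¬nonpos-edge-with-pos-children {x} {l} {r} fV≡0 x≤0? l≤0? r≤0?)
... | false | true | true =
  (λ ()) , proj₁ (root-r refl) ∷ [] , proj₁ (root-l refl) ∷ [] , paths-l , paths-r
... | false | true | false = (λ ()) , proj₁ (root-l refl) ∷ [] , [] , paths-l , paths-r
... | false | false | true = (λ ()) , proj₁ (root-r refl) ∷ [] , [] , paths-l , paths-r
... | false | false | false = (λ ()) , [] , [] , paths-l , paths-r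

StrongUnder-node⁻ : ∀ M x l r → fV x l r ≡ 0ℤ → StrongUnder M (node x l r) →
  StrongUnder (thresholdˡ M x (lab l)) l × StrongUnder (thresholdʳ M x (lab l) (lab r)) r
StrongUnder-node⁻ M x l r fV≡0 (root , regular , special , paths-l , paths-r)
  with nonpos x in x≤0? | nonpos (lab l) in l≤0? | nonpos (lab r) in r≤0?
... | true | true | true = let ((x<end , spine) , M<end) = root refl in
  ((λ _ → spine , ⊔-lub-< M<end x<end) , paths-l) , ((λ _ → fresh-strong r (All.head regular)) , paths-r)
... | true | true | false = let ((x<end , spine) , M<end) = root refl in
  ((λ _ → spine , ⊔-lub-< M<end x<end) , paths-l) , ((λ ()) , paths-r)
... | true | false | true = let ((x<end , spine) , M<end) = root refl in
  ((λ ()) , paths-l) , ((λ _ → spine , ⊔-lub-< M<end x<end) , paths-r)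
... | true | false | false =
  ⊥-elim (¬nonpos-edge-with-pos-children {x} {l} {r} fV≡0 x≤0? l≤0? r≤0?)
... | false | true | true =
  ((λ _ → fresh-strong l (All.head special)) , paths-l)
  , ((λ _ → fresh-strong r (All.head regular)) , paths-r)
... | false | true | false = ((λ _ → fresh-strong l (All.head regular)) , paths-l) , ((λ ()) , paths-r)
... | false | false | true = ((λ ()) , paths-l) , ((λ _ → fresh-strong r (All.head regular)) , paths-r)
... | false | false | false = ((λ ()) , paths-l) , ((λ ()) , paths-r)

-- Strongest edges

isStrongest : ℤ → Tree → Bool
isStrongest M s = nonpos (lab s) ∧ (does (M <? lab s) ∧ does (spineMax s ≤? lab s))

strongestAddrs : Addr → ℤ → Tree → List Addr
strongestAddrs a M (leaf x) = if isStrongest M (leaf x) then a ∷ [] else []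
strongestAddrs a M (node x l r) =
  (if isStrongest M (node x l r) then a ∷ [] else [])
  ++ (strongestAddrs (a ∷ʳ false) (thresholdˡ M x (lab l)) l
      ++ strongestAddrs (a ∷ʳ true) (thresholdʳ M x (lab l) (lab r)) r)

-- The strongest edge of the path through the root edge of s, if it lies in s
-- (that is, if the spine of s exceeds the threshold M).

pendingStrongest : ℤ → Addr → Tree → List Addr
pendingStrongest M a s =
  if nonpos (lab s) ∧ does (M <? spineMax s) then strongestEdge (follow a s) ∷ [] else []

does-lab-1<spineMax : ∀ s → does (lab s - 1ℤ <? spineMax s) ≡ true
does-lab-1<spineMax s = dec-true (lab s - 1ℤ <? spineMax s) (lab-1<spineMax s)

pending-fresh : ∀ a s →
  pendingStrongest (lab s - 1ℤ) a s ≡ (if nonpos (lab s) then strongestEdge (follow a s) ∷ [] else [])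
pending-fresh a s rewrite does-lab-1<spineMax s | ∧-identityʳ (nonpos (lab s)) = refl

-- The strongest edge of a path x ∷ p lies in the path iff it exceeds M,
-- and it is x itself iff x ≥ max p.

strongest-split : ∀ (M x m : ℤ) (a b : Addr) →
  (if does (M <? x) ∧ does (x ⊔ m ≤? x) then a ∷ [] else [])
    ++ (if does (M ⊔ x <? m) then b ∷ [] else [])
  ≡ (if does (M <? x ⊔ m) then (if does (m ≤? x) then a else b) ∷ [] else [])
strongest-split M x m a b with m ≤? x
... | yes m≤x
  rewrite ℤₚ.i≥j⇒i⊔j≡i m≤x | dec-true (x ≤? x) ℤₚ.≤-refl
        | dec-false (M ⊔ x <? m) (λ M⊔x<m → ℤₚ.<⇒≱ M⊔x<m (ℤₚ.≤-trans m≤x (ℤₚ.i≤j⊔i M x)))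
        with does (M <? x)
...   | true  = refl
...   | false = refl
strongest-split M x m a b | no m≰x
  rewrite ℤₚ.i≤j⇒i⊔j≡j (ℤₚ.<⇒≤ (ℤₚ.≰⇒> m≰x)) | dec-false (m ≤? x) m≰x | ∧-zeroʳ (does (M <? x))
        | ≡true⇔≡true⇒≡ {does (M ⊔ x <? m)} {does (M <? m)} (mk⇔
            (λ M⊔x<m → dec-true (M <? m) (i⊔j<k⇒i<k (does≡true⇒ (M ⊔ x <? m) M⊔x<m)))
            (λ M<m → dec-true (M ⊔ x <? m) (⊔-lub-< (does≡true⇒ (M <? m) M<m) (ℤₚ.≰⇒> m≰x))))
  = refl

strongest-split-++ : ∀ (M x m : ℤ) (a b : Addr) Z →
  (if does (M <? x) ∧ does (x ⊔ m ≤? x) then a ∷ [] else [])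
    ++ ((if does (M ⊔ x <? m) then b ∷ [] else []) ++ Z)
  ↭ (if does (M <? x ⊔ m) then (if does (m ≤? x) then a else b) ∷ [] else []) ++ Z
strongest-split-++ M x m a b Z = ↭-reflexive (begin
  A ++ (B ++ Z)  ≡⟨ ++-assoc A B Z ⟨
  (A ++ B) ++ Z  ≡⟨ cong (_++ Z) (strongest-split M x m a b) ⟩
  _ ++ Z         ∎)
  where
  open ≡-Reasoning
  A = if does (M <? x) ∧ does (x ⊔ m ≤? x) then a ∷ [] else []
  B = if does (M ⊔ x <? m) then b ∷ [] else []

pending-node : ∀ a M x l r → fV x l r ≡ 0ℤ →
  (if isStrongest M (node x l r) then a ∷ [] else [])
    ++ (pendingStrongest (thresholdˡ M x (lab l)) (a ∷ʳ false) l
        ++ pendingStrongest (thresholdʳ M x (lab l) (lab r)) (a ∷ʳ true) r)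
  ↭ pendingStrongest M a (node x l r) ++ map strongestEdge (regularPaths a x l r ++ specialPaths a x l r)
pending-node a M x l r fV≡0 with nonpos x in x≤0? | nonpos (lab l) in l≤0? | nonpos (lab r) in r≤0?
... | true | true | true rewrite does-lab-1<spineMax r | follow-max (a ∷ʳ false) l =
  strongest-split-++ M x (spineMax l) a (strongestEdge (follow (a ∷ʳ false) l))
    (strongestEdge (follow (a ∷ʳ true) r) ∷ [])
... | true | true | false rewrite follow-max (a ∷ʳ false) l =
  strongest-split-++ M x (spineMax l) a (strongestEdge (follow (a ∷ʳ false) l)) []
... | true | false | true rewrite follow-max (a ∷ʳ true) r =
  ↭-reflexive (trans (strongest-split M x (spineMax r) a (strongestEdge (follow (a ∷ʳ true) r)))
                     (sym (++-identityʳ _)))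
... | true | false | false =
  ⊥-elim (¬nonpos-edge-with-pos-children {x} {l} {r} fV≡0 x≤0? l≤0? r≤0?)
... | false | true | true rewrite does-lab-1<spineMax l | does-lab-1<spineMax r =
  ↭.++-comm (strongestEdge (follow (a ∷ʳ false) l) ∷ []) (strongestEdge (follow (a ∷ʳ true) r) ∷ [])
... | false | true | false rewrite does-lab-1<spineMax l = ↭-refl
... | false | false | true rewrite does-lab-1<spineMax r = ↭-refl
... | false | false | false = ↭-refl

strongestAddrs↭ : ∀ a M s → PreQLabels s →
  strongestAddrs a M s ↭ pendingStrongest M a s ++ map strongestEdge (nodePaths a s)
strongestAddrs↭ a M (leaf x) _
  rewrite dec-true (x ≤? x) ℤₚ.≤-refl | ∧-identityʳ (does (M <? x))
        | ++-identityʳ (if nonpos x ∧ does (M <? x) then a ∷ [] else []) = ↭-refl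
strongestAddrs↭ a M (node x l r) (fV≡0 , preQ-l , preQ-r) = begin
  C ++ (Rˡ ++ Rʳ)
    ↭⟨ ++⁺ˡ C (++⁺ (strongestAddrs↭ aˡ Mˡ l preQ-l) (strongestAddrs↭ aʳ Mʳ r preQ-r)) ⟩
  C ++ ((Hˡ ++ Nˡ) ++ (Hʳ ++ Nʳ))
    ↭⟨ ++⁺ˡ C (interchange Hˡ Nˡ Hʳ Nʳ) ⟩
  C ++ ((Hˡ ++ Hʳ) ++ (Nˡ ++ Nʳ))
    ≡⟨ ++-assoc C (Hˡ ++ Hʳ) (Nˡ ++ Nʳ) ⟨
  (C ++ (Hˡ ++ Hʳ)) ++ (Nˡ ++ Nʳ)
    ↭⟨ ++⁺ʳ (Nˡ ++ Nʳ) (pending-node a M x l r fV≡0) ⟩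
  (H ++ map strongestEdge (X ++ Y)) ++ (Nˡ ++ Nʳ)
    ≡⟨ ++-assoc H _ _ ⟩
  H ++ (map strongestEdge (X ++ Y) ++ (Nˡ ++ Nʳ))
    ≡⟨ cong (λ N → H ++ (map strongestEdge (X ++ Y) ++ N)) (map-++ strongestEdge (nodePaths aˡ l) _) ⟨
  H ++ (map strongestEdge (X ++ Y) ++ map strongestEdge (nodePaths aˡ l ++ nodePaths aʳ r))
    ≡⟨ cong (H ++_) (map-++ strongestEdge (X ++ Y) _) ⟨
  H ++ map strongestEdge ((X ++ Y) ++ (nodePaths aˡ l ++ nodePaths aʳ r))
    ≡⟨ cong (λ P → H ++ map strongestEdge P) (++-assoc X Y _) ⟩
  H ++ map strongestEdge (nodePaths a (node x l r)) ∎
  where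
  open PermutationReasoning
  aˡ = a ∷ʳ false
  aʳ = a ∷ʳ true
  Mˡ = thresholdˡ M x (lab l)
  Mʳ = thresholdʳ M x (lab l) (lab r)
  C = if isStrongest M (node x l r) then a ∷ [] else []
  Rˡ = strongestAddrs aˡ Mˡ l
  Rʳ = strongestAddrs aʳ Mʳ r
  Hˡ = pendingStrongest Mˡ aˡ l
  Hʳ = pendingStrongest Mʳ aʳ r
  Nˡ = map strongestEdge (nodePaths aˡ l)
  Nʳ = map strongestEdge (nodePaths aʳ r)
  H = pendingStrongest M a (node x l r)
  X = regularPaths a x l r
  Y = specialPaths a x l r

strongestEdges↭ : ∀ t → PreQLabels t → strongestEdges t ↭ strongestAddrs [] (lab t - 1ℤ) t
strongestEdges↭ t preQ = ↭-sym (↭-trans (strongestAddrs↭ [] (lab t - 1ℤ) t preQ) (↭-reflexive root))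
  where
  root : pendingStrongest (lab t - 1ℤ) [] t ++ map strongestEdge (nodePaths [] t) ≡ strongestEdges t
  root rewrite pending-fresh [] t with nonpos (lab t)
  ... | true  = refl
  ... | false = refl

-- Truncation at the topmost strongest edges

cut : ℤ → Tree → Tree × List Tree
cut M (leaf x) = if isStrongest M (leaf x) then (leaf x , leaf x ∷ []) else (leaf x , [])
cut M (node x l r) =
  if isStrongest M (node x l r) then (leaf x , node x l r ∷ [])
  else (node x (proj₁ (cut Mˡ l)) (proj₁ (cut Mʳ r)) , proj₂ (cut Mˡ l) ++ proj₂ (cut Mʳ r))
  where
  Mˡ = thresholdˡ M x (lab l)
  Mʳ = thresholdʳ M x (lab l) (lab r)

trunk : ℤ → Tree → Tree
trunk M s = proj₁ (cut M s)

pieces : ℤ → Tree → List Tree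
pieces M s = proj₂ (cut M s)

_≼_ : Addr → Addr → Set
a ≼ c = ∃ λ d → c ≡ a ++ d

∷ʳ-≼⇒≼ : ∀ {a z c} → (a ∷ʳ z) ≼ c → a ≼ c
∷ʳ-≼⇒≼ {a} {z} (d , c≡) = z ∷ d , trans c≡ (++-assoc a (z ∷ []) d)

∷ʳ-≼-injective : ∀ {a z z′ c} → (a ∷ʳ z) ≼ c → (a ∷ʳ z′) ≼ c → z ≡ z′
∷ʳ-≼-injective {a} {z} {z′} (d , c≡) (d′ , c≡′) =
  ∷-injectiveˡ (++-cancelˡ a (z ∷ d) (z′ ∷ d′)
    (trans (sym (proj₂ (∷ʳ-≼⇒≼ (d , c≡)))) (proj₂ (∷ʳ-≼⇒≼ (d′ , c≡′)))))

¬∷ʳ-≼-self : ∀ {a z} → ¬ (a ∷ʳ z) ≼ a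
¬∷ʳ-≼-self {a} a∷ʳz≼a with ++-cancelˡ a [] _ (trans (++-identityʳ a) (proj₂ (∷ʳ-≼⇒≼ a∷ʳz≼a)))
... | ()

no-strictPrefix-[] : ∀ b → isStrictPrefix b [] ≡ false
no-strictPrefix-[] [] = refl
no-strictPrefix-[] (_ ∷ _) = refl

strictPrefix-∷ʳ : ∀ b a z → isStrictPrefix b (a ∷ʳ z) ≡ true → b ≡ a ⊎ isStrictPrefix b a ≡ true
strictPrefix-∷ʳ [] [] z _ = inj₁ refl
strictPrefix-∷ʳ [] (_ ∷ _) z _ = inj₂ refl
strictPrefix-∷ʳ (y ∷ b) [] z b<z
  with () ← trans (sym (no-strictPrefix-[] b)) (∧-conicalʳ (does (y BP.≟ z)) _ b<z)
strictPrefix-∷ʳ (y ∷ b) (y′ ∷ a) z b<a with y BP.≟ y′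
... | yes refl = Sum.map (cong (y ∷_)) id (strictPrefix-∷ʳ b a z b<a)
strictPrefix-∷ʳ (y ∷ b) (y′ ∷ a) z () | no _

strongestAddrs-node : ∀ a M x l r → isStrongest M (node x l r) ≡ false →
  strongestAddrs a M (node x l r)
  ≡ strongestAddrs (a ∷ʳ false) (thresholdˡ M x (lab l)) l
    ++ strongestAddrs (a ∷ʳ true) (thresholdʳ M x (lab l) (lab r)) r
strongestAddrs-node a M x l r not-strongest =
  cong (λ b → (if b then a ∷ [] else []) ++ (Rˡ ++ Rʳ)) not-strongest
  where
  Rˡ = strongestAddrs (a ∷ʳ false) (thresholdˡ M x (lab l)) l
  Rʳ = strongestAddrs (a ∷ʳ true) (thresholdʳ M x (lab l) (lab r)) r

strongestAddrs-below : ∀ a M s {c} → c ∈ strongestAddrs a M s → a ≼ c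
strongestAddrs-below a M (leaf x) c∈ =
  [] , trans (proj₁ (∈-if (isStrongest M (leaf x)) c∈)) (sym (++-identityʳ a))
strongestAddrs-below a M (node x l r) c∈ with ∈-++⁻ (if isStrongest M (node x l r) then a ∷ [] else []) c∈
... | inj₁ c∈root = [] , trans (proj₁ (∈-if (isStrongest M (node x l r)) c∈root)) (sym (++-identityʳ a))
... | inj₂ c∈children with ∈-++⁻ (strongestAddrs (a ∷ʳ false) _ l) c∈children
...   | inj₁ c∈l = ∷ʳ-≼⇒≼ (strongestAddrs-below (a ∷ʳ false) _ l c∈l)
...   | inj₂ c∈r = ∷ʳ-≼⇒≼ (strongestAddrs-below (a ∷ʳ true) _ r c∈r)

self∈strongestAddrs⇔ : ∀ a M s → a ∈ strongestAddrs a M s ⇔ isStrongest M s ≡ true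
self∈strongestAddrs⇔ a M (leaf x) = mk⇔
  (λ a∈ → proj₂ (∈-if (isStrongest M (leaf x)) a∈))
  (λ strongest → subst (λ b → a ∈ (if b then a ∷ [] else [])) (sym strongest) (here refl))
self∈strongestAddrs⇔ a M (node x l r) = mk⇔ ⇒ ⇐
  where
  C = if isStrongest M (node x l r) then a ∷ [] else []
  ⇒ : a ∈ strongestAddrs a M (node x l r) → isStrongest M (node x l r) ≡ true
  ⇒ a∈ with ∈-++⁻ C a∈
  ... | inj₁ a∈root = proj₂ (∈-if (isStrongest M (node x l r)) a∈root)
  ... | inj₂ a∈children with ∈-++⁻ (strongestAddrs (a ∷ʳ false) _ l) a∈children
  ...   | inj₁ a∈l = ⊥-elim (¬∷ʳ-≼-self (strongestAddrs-below (a ∷ʳ false) _ l a∈l))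
  ...   | inj₂ a∈r = ⊥-elim (¬∷ʳ-≼-self (strongestAddrs-below (a ∷ʳ true) _ r a∈r))
  ⇐ : isStrongest M (node x l r) ≡ true → a ∈ strongestAddrs a M (node x l r)
  ⇐ strongest = ∈-++⁺ˡ (subst (λ b → a ∈ (if b then a ∷ [] else [])) (sym strongest) (here refl))

-- The invariants under which trunc (inD t) and cut descend in lockstep.

Agrees : List Addr → Addr → ℤ → Tree → Set
Agrees S a M s = ∀ {c} → a ≼ c → c ∈ S ⇔ c ∈ strongestAddrs a M s

NoneAbove : List Addr → Addr → Set
NoneAbove S a = ∀ b → isStrictPrefix b a ≡ true → b ∉ S

Agrees-root : ∀ {S a} M s → Agrees S a M s → a ∈ S ⇔ isStrongest M s ≡ true
Agrees-root {a = a} M s agrees =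
  ⇔-trans (agrees ([] , sym (++-identityʳ a))) (self∈strongestAddrs⇔ a M s)

Agrees-children : ∀ {S a} M x l r → isStrongest M (node x l r) ≡ false → Agrees S a M (node x l r) →
  Agrees S (a ∷ʳ false) (thresholdˡ M x (lab l)) l × Agrees S (a ∷ʳ true) (thresholdʳ M x (lab l) (lab r)) r
Agrees-children {S} {a} M x l r not-strongest agrees = agreesˡ , agreesʳ
  where
  Rˡ = strongestAddrs (a ∷ʳ false) (thresholdˡ M x (lab l)) l
  Rʳ = strongestAddrs (a ∷ʳ true) (thresholdʳ M x (lab l) (lab r)) r
  agrees-children : ∀ {c} → a ≼ c → c ∈ S ⇔ c ∈ Rˡ ++ Rʳ
  agrees-children a≼c = subst (λ R → _ ∈ S ⇔ _ ∈ R) (strongestAddrs-node a M x l r not-strongest) (agrees a≼c)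
  agreesˡ : Agrees S (a ∷ʳ false) _ l
  agreesˡ al≼c = ⇔-trans (agrees-children (∷ʳ-≼⇒≼ al≼c))
    (∈-++⇔ˡ Rˡ (λ c∈Rʳ → contradiction (∷ʳ-≼-injective al≼c (strongestAddrs-below _ _ r c∈Rʳ)) λ ()))
  agreesʳ : Agrees S (a ∷ʳ true) _ r
  agreesʳ ar≼c = ⇔-trans (agrees-children (∷ʳ-≼⇒≼ ar≼c))
    (∈-++⇔ʳ Rˡ (λ c∈Rˡ → contradiction (∷ʳ-≼-injective ar≼c (strongestAddrs-below _ _ l c∈Rˡ)) λ ()))

NoneAbove-child : ∀ {S a} M s z → isStrongest M s ≡ false → Agrees S a M s → NoneAbove S a →
  NoneAbove S (a ∷ʳ z)
NoneAbove-child {a = a} M s z not-strongest agrees none b b<az b∈S with strictPrefix-∷ʳ b a z b<az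
... | inj₂ b<a = none b b<a b∈S
... | inj₁ refl = contradiction (trans (sym not-strongest) (to (Agrees-root M s agrees) b∈S)) λ ()

inD⇔ : ∀ t a → inD t a ≡ true ⇔ (a ∈ strongestEdges t × NoneAbove (strongestEdges t) a)
inD⇔ t a = ⇔-trans inD⇔∈D (⇔-trans (∈-filter⇔ (T? ∘ notBelow)) (⇔-refl ×-⇔ notBelow⇔))
  where
  S = strongestEdges t
  notBelow : Addr → Bool
  notBelow c = not (any (λ b → isStrictPrefix b c) S)
  inD⇔∈D : inD t a ≡ true ⇔ a ∈ Dset t
  inD⇔∈D = mk⇔
    (λ inD≡true → Any.map (λ {b} → to (T-does⇔ (a ≟A b))) (any⁻ _ (Dset t) (from T-≡ inD≡true)))
    (λ a∈D → to T-≡ (any⁺ _ (Any.map (λ {b} → from (T-does⇔ (a ≟A b))) a∈D)))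
  ∈-filter⇔ : ∀ {P : Addr → Set} (P? : Decidable P) → a ∈ filter P? S ⇔ (a ∈ S × P a)
  ∈-filter⇔ P? = mk⇔ (∈-filter⁻ P?) (λ (a∈S , Pa) → ∈-filter⁺ P? a∈S Pa)
  notBelow⇔ : T (notBelow a) ⇔ NoneAbove S a
  notBelow⇔ = ⇔-trans T-not⇔¬T (mk⇔
    (λ ¬any b b<a b∈S → ¬any (any⁺ _ (lose b∈S (from T-≡ b<a))))
    (λ none any → let (b , b∈S , b<a) = find (any⁻ _ S any) in none b (to T-≡ b<a) b∈S))

inD≡isStrongest : ∀ t a M s → Agrees (strongestEdges t) a M s → NoneAbove (strongestEdges t) a →
  inD t a ≡ isStrongest M s
inD≡isStrongest t a M s agrees none = ≡true⇔≡true⇒≡ (mk⇔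
  (λ inD≡true → to (Agrees-root M s agrees) (proj₁ (to (inD⇔ t a) inD≡true)))
  (λ strongest → from (inD⇔ t a) (from (Agrees-root M s agrees) strongest , none)))

trunc≡cut : ∀ t a M s → Agrees (strongestEdges t) a M s → NoneAbove (strongestEdges t) a →
  trunc (inD t) a s ≡ cut M s
trunc≡cut t a M (leaf x) agrees none rewrite inD≡isStrongest t a M (leaf x) agrees none = refl
trunc≡cut t a M (node x l r) agrees none
  rewrite inD≡isStrongest t a M (node x l r) agrees none =
  if-else-cong (isStrongest M (node x l r)) λ not-strongest →
    let agreesˡ , agreesʳ = Agrees-children M x l r not-strongest agrees
        noneAbove z = NoneAbove-child M (node x l r) z not-strongest agrees none
    in cong₂ (λ u v → node x (proj₁ u) (proj₁ v) , proj₂ u ++ proj₂ v)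
         (trunc≡cut t (a ∷ʳ false) _ l agreesˡ (noneAbove false))
         (trunc≡cut t (a ∷ʳ true) _ r agreesʳ (noneAbove true))

φ≡cut : ∀ t → PreQLabels t → φ t ≡ (trunk (lab t - 1ℤ) t , map rebase (pieces (lab t - 1ℤ) t))
φ≡cut t preQ = cong (λ (q₀ , qs) → q₀ , map rebase qs) (trunc≡cut t [] (lab t - 1ℤ) t agrees none)
  where
  agrees : Agrees (strongestEdges t) [] (lab t - 1ℤ) t
  agrees _ = mk⇔ (∈-resp-↭ (strongestEdges↭ t preQ)) (∈-resp-↭ (↭-sym (strongestEdges↭ t preQ)))
  none : NoneAbove (strongestEdges t) []
  none b b<[] = contradiction (trans (sym (no-strictPrefix-[] b)) b<[]) λ ()

lab-rebaseBy : ∀ c s → lab (rebaseBy c s) ≡ lab s - c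
lab-rebaseBy c (leaf x) = refl
lab-rebaseBy c (node x l r) with nonpos (lab l)
... | true  = refl
... | false = refl

leaves-rebaseBy : ∀ c s → leaves (rebaseBy c s) ≡ leaves s
leaves-rebaseBy c (leaf x) = refl
leaves-rebaseBy c (node x l r) with nonpos (lab l)
... | true  = cong (ℕ._+ leaves r) (leaves-rebaseBy c l)
... | false = cong (leaves l ℕ.+_) (leaves-rebaseBy c r)

leaves-map-rebase : ∀ ss → map leaves (map rebase ss) ≡ map leaves ss
leaves-map-rebase ss = trans (sym (map-∘ ss)) (map-cong (λ s → leaves-rebaseBy (lab s) s) ss)

rebaseBy-preQ : ∀ c s → PreQLabels s → spineMax s ℤ.≤ c → PreQLabels (rebaseBy c s)
rebaseBy-preQ c (leaf x) _ x≤c = x≤c⇒x-c≤0 x≤c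
rebaseBy-preQ c (node x l r) (fV≡0 , preQ-l , preQ-r) max≤c with nonpos (lab l)
... | true rewrite lab-rebaseBy c l =
  trans (fV-shiftˡ (lab l) (lab r) x (ℤ.- c)) fV≡0
  , rebaseBy-preQ c l preQ-l (ℤₚ.i⊔j≤k⇒j≤k x _ max≤c) , preQ-r
... | false rewrite lab-rebaseBy c r =
  trans (fV-shiftʳ (lab l) (lab r) x (ℤ.- c)) fV≡0
  , preQ-l , rebaseBy-preQ c r preQ-r (ℤₚ.i⊔j≤k⇒j≤k x _ max≤c)

raiseBy : ℤ → Tree → Tree
raiseBy c (leaf x) = leaf (x +ℤ c)
raiseBy c (node x l r) =
  if nonpos (lab l) then node (x +ℤ c) (raiseBy c l) r
                    else node (x +ℤ c) l (raiseBy c r)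

lab-raiseBy : ∀ c q → lab (raiseBy c q) ≡ lab q +ℤ c
lab-raiseBy c (leaf y) = refl
lab-raiseBy c (node x l r) with nonpos (lab l)
... | true  = refl
... | false = refl

raiseBy-preQ : ∀ c q → PreQLabels q → c ℤ.≤ 0ℤ → lab q ℤ.≤ 0ℤ → PreQLabels (raiseBy c q)
raiseBy-preQ c (leaf y) _ c≤0 y≤0 = ℤₚ.+-mono-≤ y≤0 c≤0
raiseBy-preQ c (node x l r) (fV≡0 , preQ-l , preQ-r) c≤0 x≤0 with nonpos (lab l) in l≤0
... | true rewrite lab-raiseBy c l =
  trans (fV-shiftˡ (lab l) (lab r) x c) fV≡0 , raiseBy-preQ c l preQ-l c≤0 (nonpos⇒≤0 l≤0) , preQ-r
... | false rewrite lab-raiseBy c r =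
  trans (fV-shiftʳ (lab l) (lab r) x c) fV≡0 , preQ-l
  , raiseBy-preQ c r preQ-r c≤0 (nonpos-edge-has-nonpos-child {x} {l} {r} fV≡0 x≤0 l≤0)

spineMax-raiseBy : ∀ c q → PreQLabels q → c ℤ.≤ 0ℤ → lab q ℤ.≤ 0ℤ → spineMax (raiseBy c q) ℤ.≤ c
spineMax-raiseBy c (leaf y) _ c≤0 y≤0 = x≤0⇒x+c≤c c y≤0
spineMax-raiseBy c (node x l r) (fV≡0 , preQ-l , preQ-r) c≤0 x≤0 with nonpos (lab l) in l≤0
... | true rewrite lab-raiseBy c l | dec-true (lab l +ℤ c ≤? 0ℤ) (ℤₚ.+-mono-≤ (nonpos⇒≤0 {lab l} l≤0) c≤0) =
  ℤₚ.⊔-lub (x≤0⇒x+c≤c c x≤0) (spineMax-raiseBy c l preQ-l c≤0 (nonpos⇒≤0 l≤0))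
... | false rewrite l≤0 =
  ℤₚ.⊔-lub (x≤0⇒x+c≤c c x≤0)
    (spineMax-raiseBy c r preQ-r c≤0 (nonpos-edge-has-nonpos-child {x} {l} {r} fV≡0 x≤0 l≤0))

raiseBy-rebaseBy : ∀ c s → spineMax s ℤ.≤ c → raiseBy c (rebaseBy c s) ≡ s
raiseBy-rebaseBy c (leaf x) _ = cong leaf (x-c+c≡x x c)
raiseBy-rebaseBy c (node x l r) max≤c with nonpos (lab l) in l≤0
... | true
  rewrite lab-rebaseBy c l
        | ≤0⇒nonpos (x≤c⇒x-c≤0 (ℤₚ.≤-trans (lab≤spineMax l) (ℤₚ.i⊔j≤k⇒j≤k x _ max≤c))) =
  cong₂ (λ y l′ → node y l′ r) (x-c+c≡x x c) (raiseBy-rebaseBy c l (ℤₚ.i⊔j≤k⇒j≤k x _ max≤c))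
... | false rewrite l≤0 =
  cong₂ (λ y r′ → node y l r′) (x-c+c≡x x c) (raiseBy-rebaseBy c r (ℤₚ.i⊔j≤k⇒j≤k x _ max≤c))

rebaseBy-raiseBy : ∀ c q → c ℤ.≤ 0ℤ → rebaseBy c (raiseBy c q) ≡ q
rebaseBy-raiseBy c (leaf y) _ = cong leaf (x+c-c≡x y c)
rebaseBy-raiseBy c (node x l r) c≤0 with nonpos (lab l) in l≤0
... | true rewrite lab-raiseBy c l | dec-true (lab l +ℤ c ≤? 0ℤ) (ℤₚ.+-mono-≤ (nonpos⇒≤0 {lab l} l≤0) c≤0) =
  cong₂ (λ y l′ → node y l′ r) (x+c-c≡x x c) (rebaseBy-raiseBy c l c≤0)
... | false rewrite l≤0 =
  cong₂ (λ y r′ → node y l r′) (x+c-c≡x x c) (rebaseBy-raiseBy c r c≤0)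

-- The invariant of cut: the path through the root edge of s has its strongest
-- edge in s.  It guarantees that cut removes a subtree above every leaf.

Exceeds : ℤ → Tree → Set
Exceeds M s = nonpos (lab s) ≡ true → M ℤ.< spineMax s

Exceeds-fresh : ∀ s → Exceeds (lab s - 1ℤ) s
Exceeds-fresh s _ = lab-1<spineMax s

strongest-below : ∀ M x m → M ℤ.< x ⊔ m → does (M <? x) ∧ does (x ⊔ m ≤? x) ≡ false → M ⊔ x ℤ.< m
strongest-below M x m M<x⊔m not-here with m ≤? x
... | yes m≤x = contradiction (trans (sym not-here) strongest-here) λ ()
  where
  x⊔m≡x = ℤₚ.i≥j⇒i⊔j≡i m≤x
  strongest-here : does (M <? x) ∧ does (x ⊔ m ≤? x) ≡ true
  strongest-here = cong₂ _∧_ (dec-true (M <? x) (subst (M ℤ.<_) x⊔m≡x M<x⊔m))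
                             (dec-true (x ⊔ m ≤? x) (ℤₚ.≤-reflexive x⊔m≡x))
... | no m≰x = ⊔-lub-< (subst (M ℤ.<_) (ℤₚ.i≤j⇒i⊔j≡j (ℤₚ.<⇒≤ x<m)) M<x⊔m) x<m
  where x<m = ℤₚ.≰⇒> m≰x

Exceeds-children : ∀ M x l r → isStrongest M (node x l r) ≡ false → Exceeds M (node x l r) →
  Exceeds (thresholdˡ M x (lab l)) l × Exceeds (thresholdʳ M x (lab l) (lab r)) r
Exceeds-children M x l r not-strongest exceeds with nonpos x | nonpos (lab l)
... | true | true  = (λ _ → strongest-below M x (spineMax l) (exceeds refl) not-strongest)
                     , (λ _ → lab-1<spineMax r)
... | true | false = (λ ()) , (λ _ → strongest-below M x (spineMax r) (exceeds refl) not-strongest)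
... | false | _    = (λ _ → lab-1<spineMax l) , (λ _ → lab-1<spineMax r)

isStrongest-intro : ∀ M s → lab s ℤ.≤ 0ℤ → M ℤ.< lab s → spineMax s ℤ.≤ lab s → isStrongest M s ≡ true
isStrongest-intro M s s≤0 M<s max≤s
  rewrite ≤0⇒nonpos s≤0 | dec-true (M <? lab s) M<s | dec-true (spineMax s ≤? lab s) max≤s = refl

leaf-isStrongest : ∀ M x → x ℤ.≤ 0ℤ → Exceeds M (leaf x) → isStrongest M (leaf x) ≡ true
leaf-isStrongest M x x≤0 exceeds = isStrongest-intro M (leaf x) x≤0 (exceeds (≤0⇒nonpos x≤0)) ℤₚ.≤-refl

isStrongest⇒spineMax≤lab : ∀ M s → isStrongest M s ≡ true → spineMax s ℤ.≤ lab s
isStrongest⇒spineMax≤lab M s strongest =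
  does≡true⇒ (spineMax s ≤? lab s) (∧-conicalʳ _ _ (∧-conicalʳ (nonpos (lab s)) _ strongest))

cut-isStrongest : ∀ M s → isStrongest M s ≡ true → cut M s ≡ (leaf (lab s) , s ∷ [])
cut-isStrongest M (leaf x) strongest rewrite strongest = refl
cut-isStrongest M (node x l r) strongest rewrite strongest = refl

lab-trunk : ∀ M s → lab (trunk M s) ≡ lab s
lab-trunk M (leaf x) with isStrongest M (leaf x)
... | true  = refl
... | false = refl
lab-trunk M (node x l r) with isStrongest M (node x l r)
... | true  = refl
... | false = refl

leaves-trunk : ∀ M s → PreQLabels s → Exceeds M s → leaves (trunk M s) ≡ length (pieces M s)
leaves-trunk M (leaf x) x≤0 exceeds rewrite leaf-isStrongest M x x≤0 exceeds = refl
leaves-trunk M (node x l r) (_ , preQ-l , preQ-r) exceeds with isStrongest M (node x l r) in strongest?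
... | true  = refl
... | false =
  let exceedsˡ , exceedsʳ = Exceeds-children M x l r strongest? exceeds in
  trans (cong₂ ℕ._+_ (leaves-trunk _ l preQ-l exceedsˡ) (leaves-trunk _ r preQ-r exceedsʳ))
        (sym (length-++ (pieces (thresholdˡ M x (lab l)) l)))

leaves-pieces : ∀ M s → PreQLabels s → Exceeds M s → sum (map leaves (pieces M s)) ≡ leaves s
leaves-pieces M (leaf x) x≤0 exceeds rewrite leaf-isStrongest M x x≤0 exceeds = refl
leaves-pieces M (node x l r) (_ , preQ-l , preQ-r) exceeds with isStrongest M (node x l r) in strongest?
... | true  = ℕₚ.+-identityʳ _
... | false = begin
  sum (map leaves (Pˡ ++ Pʳ))                      ≡⟨ cong sum (map-++ leaves Pˡ Pʳ) ⟩
  sum (map leaves Pˡ ++ map leaves Pʳ)             ≡⟨ sum-++ (map leaves Pˡ) (map leaves Pʳ) ⟩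
  sum (map leaves Pˡ) ℕ.+ sum (map leaves Pʳ)      ≡⟨ cong₂ ℕ._+_ (leaves-pieces _ l preQ-l exceedsˡ)
                                                                  (leaves-pieces _ r preQ-r exceedsʳ) ⟩
  leaves l ℕ.+ leaves r                            ∎
  where
  open ≡-Reasoning
  Pˡ = pieces (thresholdˡ M x (lab l)) l
  Pʳ = pieces (thresholdʳ M x (lab l) (lab r)) r
  exceedsˡ = proj₁ (Exceeds-children M x l r strongest? exceeds)
  exceedsʳ = proj₂ (Exceeds-children M x l r strongest? exceeds)

trunk-preQ : ∀ M s → PreQLabels s → PreQLabels (trunk M s)
trunk-preQ M (leaf x) x≤0 with isStrongest M (leaf x)
... | true  = x≤0
... | false = x≤0
trunk-preQ M (node x l r) (fV≡0 , preQ-l , preQ-r) with isStrongest M (node x l r) in strongest?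
... | true  = nonpos⇒≤0 (∧-conicalˡ (nonpos x) _ strongest?)
... | false =
  fV-resp-lab x l r (trunk _ l) (trunk _ r) (lab-trunk _ l) (lab-trunk _ r) fV≡0
  , trunk-preQ _ l preQ-l , trunk-preQ _ r preQ-r

trunk-strong : ∀ M s → PreQLabels s → Exceeds M s → StrongUnder M (trunk M s)
trunk-strong M (leaf x) x≤0 exceeds rewrite leaf-isStrongest M x x≤0 exceeds = (λ x≤0 → tt , exceeds x≤0) , tt
trunk-strong M (node x l r) (fV≡0 , preQ-l , preQ-r) exceeds with isStrongest M (node x l r) in strongest?
... | true  = (λ _ → tt , does≡true⇒ (M <? x) (∧-conicalˡ _ _ (∧-conicalʳ (nonpos x) _ strongest?))) , tt
... | false =
  StrongUnder-node⁺ M x l′ r′ (fV-resp-lab x l r l′ r′ (lab-trunk Mˡ l) (lab-trunk Mʳ r) fV≡0)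
    (subst (λ y → StrongUnder (thresholdˡ M x y) l′) (sym (lab-trunk Mˡ l))
       (trunk-strong Mˡ l preQ-l exceedsˡ))
    (subst₂ (λ y z → StrongUnder (thresholdʳ M x y z) r′) (sym (lab-trunk Mˡ l)) (sym (lab-trunk Mʳ r))
       (trunk-strong Mʳ r preQ-r exceedsʳ))
  where
  Mˡ = thresholdˡ M x (lab l)
  Mʳ = thresholdʳ M x (lab l) (lab r)
  l′ = trunk Mˡ l
  r′ = trunk Mʳ r
  exceedsˡ = proj₁ (Exceeds-children M x l r strongest? exceeds)
  exceedsʳ = proj₂ (Exceeds-children M x l r strongest? exceeds)

IsPreQ₀ : Tree → Set
IsPreQ₀ q = IsPreQ (leaves q) 0ℤ q

rebase-preQ : ∀ M s → PreQLabels s → isStrongest M s ≡ true → IsPreQ₀ (rebase s)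
rebase-preQ M s preQ strongest =
  refl , trans (lab-rebaseBy (lab s) s) (ℤₚ.+-inverseʳ (lab s))
  , rebaseBy-preQ (lab s) s preQ (isStrongest⇒spineMax≤lab M s strongest)

pieces-preQ : ∀ M s → PreQLabels s → All (IsPreQ₀ ∘ rebase) (pieces M s)
pieces-preQ M (leaf x) preQ with isStrongest M (leaf x) in strongest?
... | true  = rebase-preQ M (leaf x) preQ strongest? ∷ []
... | false = []
pieces-preQ M (node x l r) preQ with isStrongest M (node x l r) in strongest?
... | true  = rebase-preQ M (node x l r) preQ strongest? ∷ []
... | false = Allₚ.++⁺ (pieces-preQ _ l (proj₁ (proj₂ preQ))) (pieces-preQ _ r (proj₂ (proj₂ preQ)))

-- Grafting

-- Graft the trees qs, raised back, onto the leaves of s from left to right;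
-- the second component holds the unused trees.

graftAll : Tree → List Tree → Tree × List Tree
graftAll (leaf x) [] = leaf x , []
graftAll (leaf x) (q ∷ qs) = raiseBy x q , qs
graftAll (node x l r) qs =
  node x (proj₁ (graftAll l qs)) (proj₁ (graftAll r (proj₂ (graftAll l qs))))
  , proj₂ (graftAll r (proj₂ (graftAll l qs)))

grafted : Tree → List Tree → Tree
grafted s qs = proj₁ (graftAll s qs)

leftover : Tree → List Tree → List Tree
leftover s qs = proj₂ (graftAll s qs)

graft : Tree × List Tree → Tree
graft (q₀ , qs) = grafted q₀ qs

graftAll-node : ∀ x l r qs {l′ r′ qs′ qs″} → graftAll l qs ≡ (l′ , qs′) → graftAll r qs′ ≡ (r′ , qs″) →
  graftAll (node x l r) qs ≡ (node x l′ r′ , qs″)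
graftAll-node x l r qs graftˡ graftʳ rewrite graftˡ | graftʳ = refl

graftAll-cut : ∀ M s rest → PreQLabels s → Exceeds M s →
  graftAll (trunk M s) (map rebase (pieces M s) ++ rest) ≡ (s , rest)
graftAll-cut M (leaf x) rest x≤0 exceeds rewrite leaf-isStrongest M x x≤0 exceeds =
  cong (_, rest) (raiseBy-rebaseBy x (leaf x) ℤₚ.≤-refl)
graftAll-cut M (node x l r) rest (_ , preQ-l , preQ-r) exceeds with isStrongest M (node x l r) in strongest?
... | true =
  cong (_, rest) (raiseBy-rebaseBy x (node x l r) (isStrongest⇒spineMax≤lab M (node x l r) strongest?))
... | false = begin
  graftAll (node x l′ r′) (map rebase (Pˡ ++ Pʳ) ++ rest)
    ≡⟨ cong (λ qs → graftAll (node x l′ r′) (qs ++ rest)) (map-++ rebase Pˡ Pʳ) ⟩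
  graftAll (node x l′ r′) ((map rebase Pˡ ++ map rebase Pʳ) ++ rest)
    ≡⟨ cong (graftAll (node x l′ r′)) (++-assoc (map rebase Pˡ) (map rebase Pʳ) rest) ⟩
  graftAll (node x l′ r′) (map rebase Pˡ ++ (map rebase Pʳ ++ rest))
    ≡⟨ graftAll-node x l′ r′ _ (graftAll-cut Mˡ l _ preQ-l exceedsˡ)
                               (graftAll-cut Mʳ r rest preQ-r exceedsʳ) ⟩
  (node x l r , rest) ∎
  where
  open ≡-Reasoning
  Mˡ = thresholdˡ M x (lab l)
  Mʳ = thresholdʳ M x (lab l) (lab r)
  l′ = trunk Mˡ l
  r′ = trunk Mʳ r
  Pˡ = pieces Mˡ l
  Pʳ = pieces Mʳ r
  exceedsˡ = proj₁ (Exceeds-children M x l r strongest? exceeds)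
  exceedsʳ = proj₂ (Exceeds-children M x l r strongest? exceeds)

graft∘φ : ∀ q → PreQLabels q → graft (φ q) ≡ q
graft∘φ q preQ = begin
  graft (φ q)                                          ≡⟨ cong graft (φ≡cut q preQ) ⟩
  grafted (trunk M q) (map rebase (pieces M q))        ≡⟨ cong (grafted (trunk M q)) (++-identityʳ _) ⟨
  grafted (trunk M q) (map rebase (pieces M q) ++ [])  ≡⟨ cong proj₁ (graftAll-cut M q [] preQ (Exceeds-fresh q)) ⟩
  q                                                    ∎
  where
  open ≡-Reasoning
  M = lab q - 1ℤ

φ-injective : ∀ {q q′} → PreQLabels q → PreQLabels q′ → φ q ≡ φ q′ → q ≡ q′
φ-injective {q} {q′} preQ preQ′ φq≡φq′ = begin
  q             ≡⟨ graft∘φ q preQ ⟨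
  graft (φ q)   ≡⟨ cong graft φq≡φq′ ⟩
  graft (φ q′)  ≡⟨ graft∘φ q′ preQ′ ⟩
  q′            ∎
  where open ≡-Reasoning

leftover-All : ∀ {P : Tree → Set} s qs → All P qs → All P (leftover s qs)
leftover-All (leaf x) [] all = all
leftover-All (leaf x) (q ∷ qs) (_ ∷ all) = all
leftover-All (node x l r) qs all = leftover-All r _ (leftover-All l qs all)

lab-raiseBy-lab≡0 : ∀ c q → lab q ≡ 0ℤ → lab (raiseBy c q) ≡ c
lab-raiseBy-lab≡0 c q lab≡0 = trans (lab-raiseBy c q) (trans (cong (_+ℤ c) lab≡0) (ℤₚ.+-identityˡ c))

lab-grafted : ∀ s qs → All IsPreQ₀ qs → lab (grafted s qs) ≡ lab s
lab-grafted (leaf x) [] _ = refl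
lab-grafted (leaf x) (q ∷ qs) ((_ , lab≡0 , _) ∷ _) = lab-raiseBy-lab≡0 x q lab≡0
lab-grafted (node x l r) qs _ = refl

grafted-preQ : ∀ s qs → PreQLabels s → All IsPreQ₀ qs → PreQLabels (grafted s qs)
grafted-preQ (leaf x) [] x≤0 _ = x≤0
grafted-preQ (leaf x) (q ∷ qs) x≤0 ((_ , lab≡0 , preQ) ∷ _) = raiseBy-preQ x q preQ x≤0 (ℤₚ.≤-reflexive lab≡0)
grafted-preQ (node x l r) qs (fV≡0 , preQ-l , preQ-r) all =
  fV-resp-lab x l r (grafted l qs) (grafted r qs′) (lab-grafted l qs all) (lab-grafted r qs′ all′) fV≡0
  , grafted-preQ l qs preQ-l all , grafted-preQ r qs′ preQ-r all′
  where
  qs′ = leftover l qs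
  all′ = leftover-All l qs all

spineEnd≤spineMax-grafted : ∀ s qs → All IsPreQ₀ qs → spineEnd s ℤ.≤ spineMax (grafted s qs)
spineEnd≤spineMax-grafted (leaf x) [] _ = ℤₚ.≤-refl
spineEnd≤spineMax-grafted (leaf x) (q ∷ qs) ((_ , lab≡0 , _) ∷ _) =
  subst (ℤ._≤ spineMax (raiseBy x q)) (lab-raiseBy-lab≡0 x q lab≡0) (lab≤spineMax (raiseBy x q))
spineEnd≤spineMax-grafted (node x l r) qs all rewrite lab-grafted l qs all with nonpos (lab l)
... | true  = ℤₚ.≤-trans (spineEnd≤spineMax-grafted l qs all) (ℤₚ.i≤j⊔i x _)
... | false = ℤₚ.≤-trans (spineEnd≤spineMax-grafted r _ (leftover-All l qs all)) (ℤₚ.i≤j⊔i x _)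

leaves+length-leftover : ∀ s qs → leaves s ℕ.≤ length qs → leaves s ℕ.+ length (leftover s qs) ≡ length qs
leaves+length-leftover (leaf x) (q ∷ qs) _ = refl
leaves+length-leftover (node x l r) qs l+r≤ = begin
  leaves l ℕ.+ leaves r ℕ.+ length (leftover r qs′)    ≡⟨ ℕₚ.+-assoc (leaves l) (leaves r) _ ⟩
  leaves l ℕ.+ (leaves r ℕ.+ length (leftover r qs′))
    ≡⟨ cong (leaves l ℕ.+_) (leaves+length-leftover r qs′ r≤) ⟩
  leaves l ℕ.+ length qs′                              ≡⟨ leaves+length-leftover l qs l≤ ⟩
  length qs                                            ∎
  where
  open ≡-Reasoning
  qs′ = leftover l qs
  l≤ : leaves l ℕ.≤ length qs
  l≤ = ℕₚ.≤-trans (ℕₚ.m≤m+n (leaves l) (leaves r)) l+r≤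
  r≤ : leaves r ℕ.≤ length qs′
  r≤ = ℕₚ.+-cancelˡ-≤ (leaves l) _ _
         (subst (leaves l ℕ.+ leaves r ℕ.≤_) (sym (leaves+length-leftover l qs l≤)) l+r≤)

leftover-exhausted : ∀ s qs → leaves s ≡ length qs → leftover s qs ≡ []
leftover-exhausted s qs leaves≡ with leftover s qs | leaves+length-leftover s qs (ℕₚ.≤-reflexive leaves≡)
... | [] | _ = refl
... | _ ∷ _ | total≡ = contradiction (trans total≡ (sym leaves≡)) (ℕₚ.m+1+n≢m (leaves s))

x<spineMax-grafted : ∀ x l r qs → All IsPreQ₀ qs → StrongSpine (node x l r) →
  x ℤ.< spineMax (grafted (node x l r) qs)
x<spineMax-grafted x l r qs all strong rewrite lab-grafted l qs all with nonpos (lab l)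
... | true  = ℤₚ.<-≤-trans (proj₁ strong)
                (ℤₚ.≤-trans (spineEnd≤spineMax-grafted l qs all) (ℤₚ.i≤j⊔i x _))
... | false = ℤₚ.<-≤-trans (proj₁ strong)
                (ℤₚ.≤-trans (spineEnd≤spineMax-grafted r _ (leftover-All l qs all)) (ℤₚ.i≤j⊔i x _))

grafted-node-not-strongest : ∀ M x l r qs → All IsPreQ₀ qs → (nonpos x ≡ true → StrongSpine (node x l r)) →
  isStrongest M (grafted (node x l r) qs) ≡ false
grafted-node-not-strongest M x l r qs all strong with nonpos x in x≤0
... | false = refl
... | true
  rewrite dec-false (spineMax (grafted (node x l r) qs) ≤? x)
                    (ℤₚ.<⇒≱ (x<spineMax-grafted x l r qs all (strong refl))) = ∧-zeroʳ (does (M <? x))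

cut-grafted : ∀ M s qs → PreQLabels s → StrongUnder M s → All IsPreQ₀ qs → leaves s ℕ.≤ length qs →
  trunk M (grafted s qs) ≡ s × map rebase (pieces M (grafted s qs)) ++ leftover s qs ≡ qs
cut-grafted M (leaf c) (q ∷ qs) c≤0 (root , _) ((_ , lab≡0 , preQ) ∷ _) _ =
  cong proj₁ cut≡ , trans (cong (λ (_ , ps) → map rebase ps ++ qs) cut≡) (cong (_∷ qs) rebase≡q)
  where
  g = raiseBy c q
  lab≡c : lab g ≡ c
  lab≡c = lab-raiseBy-lab≡0 c q lab≡0
  strongest : isStrongest M g ≡ true
  strongest = isStrongest-intro M g
    (subst (ℤ._≤ 0ℤ) (sym lab≡c) c≤0)
    (subst (M ℤ.<_) (sym lab≡c) (proj₂ (root (≤0⇒nonpos c≤0))))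
    (subst (spineMax g ℤ.≤_) (sym lab≡c) (spineMax-raiseBy c q preQ c≤0 (ℤₚ.≤-reflexive lab≡0)))
  cut≡ : cut M g ≡ (leaf c , g ∷ [])
  cut≡ = trans (cut-isStrongest M g strongest) (cong (λ y → leaf y , g ∷ []) lab≡c)
  rebase≡q : rebase g ≡ q
  rebase≡q = trans (cong (λ y → rebaseBy y g) lab≡c) (rebaseBy-raiseBy c q c≤0)
cut-grafted M (node x l r) qs (fV≡0 , preQ-l , preQ-r) strong all l+r≤
  rewrite grafted-node-not-strongest M x l r qs all (λ x≤0 → proj₁ (proj₁ strong x≤0))
        | lab-grafted l qs all | lab-grafted r (leftover l qs) (leftover-All l qs all) =
  cong₂ (node x) (proj₁ IHˡ) (proj₁ IHʳ) , pieces≡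
  where
  open ≡-Reasoning
  Mˡ = thresholdˡ M x (lab l)
  Mʳ = thresholdʳ M x (lab l) (lab r)
  qs′ = leftover l qs
  l≤ = ℕₚ.≤-trans (ℕₚ.m≤m+n (leaves l) (leaves r)) l+r≤
  r≤ = ℕₚ.+-cancelˡ-≤ (leaves l) _ _
         (subst (leaves l ℕ.+ leaves r ℕ.≤_) (sym (leaves+length-leftover l qs l≤)) l+r≤)
  strongˡ = proj₁ (StrongUnder-node⁻ M x l r fV≡0 strong)
  strongʳ = proj₂ (StrongUnder-node⁻ M x l r fV≡0 strong)
  IHˡ = cut-grafted Mˡ l qs preQ-l strongˡ all l≤
  IHʳ = cut-grafted Mʳ r qs′ preQ-r strongʳ (leftover-All l qs all) r≤
  Pˡ = pieces Mˡ (grafted l qs)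
  Pʳ = pieces Mʳ (grafted r qs′)
  pieces≡ : map rebase (Pˡ ++ Pʳ) ++ leftover r qs′ ≡ qs
  pieces≡ = begin
    map rebase (Pˡ ++ Pʳ) ++ leftover r qs′             ≡⟨ cong (_++ leftover r qs′) (map-++ rebase Pˡ Pʳ) ⟩
    (map rebase Pˡ ++ map rebase Pʳ) ++ leftover r qs′  ≡⟨ ++-assoc (map rebase Pˡ) (map rebase Pʳ) _ ⟩
    map rebase Pˡ ++ (map rebase Pʳ ++ leftover r qs′)  ≡⟨ cong (map rebase Pˡ ++_) (proj₂ IHʳ) ⟩
    map rebase Pˡ ++ qs′                                ≡⟨ proj₂ IHˡ ⟩
    qs                                                  ∎

1≤leaves : ∀ s → 1 ℕ.≤ leaves s
1≤leaves (leaf x) = ℕ.s≤s ℕ.z≤n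
1≤leaves (node x l r) = ℕₚ.≤-trans (1≤leaves l) (ℕₚ.m≤m+n (leaves l) (leaves r))

length≤sum-leaves : ∀ ss → length ss ℕ.≤ sum (map leaves ss)
length≤sum-leaves [] = ℕ.z≤n
length≤sum-leaves (s ∷ ss) = ℕₚ.+-mono-≤ (1≤leaves s) (length≤sum-leaves ss)

cut-InTarget : ∀ q → PreQLabels q →
  InTarget (leaves q) (lab q) (trunk (lab q - 1ℤ) q , map rebase (pieces (lab q - 1ℤ) q))
cut-InTarget q preQ = 0<m , m≤n , (q₀-preQ , q₀-strong) , Allₚ.map⁺ (pieces-preQ M q preQ) , sum≡n
  where
  M = lab q - 1ℤ
  q₀ = trunk M q
  P = pieces M q
  m≡ : length (map rebase P) ≡ length P
  m≡ = length-map rebase P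
  leaves≡m : leaves q₀ ≡ length P
  leaves≡m = leaves-trunk M q preQ (Exceeds-fresh q)
  sum≡ : sum (map leaves P) ≡ leaves q
  sum≡ = leaves-pieces M q preQ (Exceeds-fresh q)
  0<m : 0 ℕ.< length (map rebase P)
  0<m = subst (0 ℕ.<_) (sym m≡) (subst (1 ℕ.≤_) leaves≡m (1≤leaves q₀))
  m≤n : length (map rebase P) ℕ.≤ leaves q
  m≤n = subst (ℕ._≤ leaves q) (sym m≡) (subst (length P ℕ.≤_) sum≡ (length≤sum-leaves P))
  q₀-preQ : IsPreQ (length (map rebase P)) (lab q) q₀
  q₀-preQ = trans leaves≡m (sym m≡) , lab-trunk M q , trunk-preQ M q preQ
  q₀-strong : All StrongPath (allPaths q₀)
  q₀-strong = from (allPaths-strong⇔ q₀)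
    (subst (λ y → StrongUnder (y - 1ℤ) q₀) (sym (lab-trunk M q)) (trunk-strong M q preQ (Exceeds-fresh q)))
  sum≡n : sum (map leaves (map rebase P)) ≡ leaves q
  sum≡n = trans (cong sum (leaves-map-rebase P)) sum≡

φ-target : ∀ n p q → IsPreQ n p q → InTarget n p (φ q)
φ-target _ _ q (refl , refl , preQ) =
  subst (InTarget (leaves q) (lab q)) (sym (φ≡cut q preQ)) (cut-InTarget q preQ)

φ-surjective : ∀ n p x → InTarget n p x → Σ Tree (λ q → IsPreQ n p q × φ q ≡ x)
φ-surjective n p (q₀ , qs) (_ , _ , ((leaves≡ , lab≡p , preQ₀) , strongPaths) , preQs , sum≡n) =
  q , (leaves≡n , trans lab≡ lab≡p , preQ) , φq≡
  where
  q = grafted q₀ qs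
  M = lab q - 1ℤ
  preQ : PreQLabels q
  preQ = grafted-preQ q₀ qs preQ₀ preQs
  lab≡ : lab q ≡ lab q₀
  lab≡ = lab-grafted q₀ qs preQs
  strong : StrongUnder M q₀
  strong = subst (λ y → StrongUnder (y - 1ℤ) q₀) (sym lab≡) (to (allPaths-strong⇔ q₀) strongPaths)
  cut≡ = cut-grafted M q₀ qs preQ₀ strong preQs (ℕₚ.≤-reflexive leaves≡)
  pieces≡ : map rebase (pieces M q) ≡ qs
  pieces≡ = begin
    map rebase (pieces M q)                       ≡⟨ ++-identityʳ _ ⟨
    map rebase (pieces M q) ++ []
      ≡⟨ cong (map rebase (pieces M q) ++_) (leftover-exhausted q₀ qs leaves≡) ⟨
    map rebase (pieces M q) ++ leftover q₀ qs     ≡⟨ proj₂ cut≡ ⟩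
    qs                                            ∎
    where open ≡-Reasoning
  φq≡ : φ q ≡ (q₀ , qs)
  φq≡ = trans (φ≡cut q preQ) (cong₂ _,_ (proj₁ cut≡) pieces≡)
  leaves≡n : leaves q ≡ n
  leaves≡n = begin
    leaves q                                      ≡⟨ leaves-pieces M q preQ (Exceeds-fresh q) ⟨
    sum (map leaves (pieces M q))                 ≡⟨ cong sum (leaves-map-rebase (pieces M q)) ⟨
    sum (map leaves (map rebase (pieces M q)))    ≡⟨ cong (sum ∘ map leaves) pieces≡ ⟩
    sum (map leaves qs)                           ≡⟨ sum≡n ⟩
    n                                             ∎
    where open ≡-Reasoning

lemma5p4 : (n : ℕ) (p : ℤ) →
    ((q : Tree) → IsPreQ n p q → InTarget n p (φ q))
    × ((q q' : Tree) → IsPreQ n p q → IsPreQ n p q' → φ q ≡ φ q' → q ≡ q')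
    × ((x : Tree × List Tree) → InTarget n p x →
         Σ Tree (λ q → IsPreQ n p q × φ q ≡ x))
lemma5p4 n p =
  φ-target n p ,
  (λ q q′ (_ , _ , preQ) (_ , _ , preQ′) → φ-injective preQ preQ′) ,
  φ-surjective n p
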